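{- Let $A$ be a cubical set. The formula $$i : \mathbb{I},\ j : \mathbb{I},\ f : (\mathbb{I} \to A) \mid \cdot \vdash f(i) = f(j)$$ holds in the internal language of the presheaf topos $\widehat{\mathcal{C}}$ if and only if $A$ is isomorphic to $\Delta(a)$ for some set $a$.
   Context: Cubical sets are presheaves on the category of cubes $\mathcal{C}$ (objects: finite sets of names; morphisms $I \to J$: functions $J \to \mathrm{dM}(I)$ into the free De Morgan algebra on $I$, composed by substitution). $\mathbb{I}$ is the interval cubical set $I \mapsto \mathrm{dM}(I)$, and $\mathbb{I} \to A$ denotes the exponential $A^{\mathbb{I}}$. $\Delta : \mathrm{Set} \to \widehat{\mathcal{C}}$ is the constant presheaf functor. The internal language is the usual higher-order logic of the topos $\widehat{\mathcal{C}}$ (Kripke–Joyal semantics). -}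

module Defs where

open import Data.Nat using (ℕ)
open import Data.Fin using (Fin)
open import Data.Product using (Σ)
open import Relation.Binary.PropositionalEquality using (_≡_)
open import Function.Bundles using (_⇔_)

-- Free De Morgan algebra dM(I) on I = Fin n, presented by terms modulo
-- the De Morgan algebra axioms (a setoid; quotients are unavailable).

data DM (n : ℕ) : Set where
  var  : Fin n → DM n
  𝟘 𝟙  : DM n
  _∧_  : DM n → DM n → DM n
  _∨_  : DM n → DM n → DM n
  ~_   : DM n → DM n

infixr 6 _∧_
infixr 5 _∨_
infix  7 ~_
infix  4 _≈_

data _≈_ {n : ℕ} : DM n → DM n → Set where
  ≈-refl  : ∀ {x} → x ≈ x
  ≈-sym   : ∀ {x y} → x ≈ y → y ≈ x
  ≈-trans : ∀ {x y z} → x ≈ y → y ≈ z → x ≈ z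
  ∧-cong  : ∀ {x x' y y'} → x ≈ x' → y ≈ y' → x ∧ y ≈ x' ∧ y'
  ∨-cong  : ∀ {x x' y y'} → x ≈ x' → y ≈ y' → x ∨ y ≈ x' ∨ y'
  ~-cong  : ∀ {x x'} → x ≈ x' → ~ x ≈ ~ x'
  ∧-assoc : ∀ x y z → (x ∧ y) ∧ z ≈ x ∧ (y ∧ z)
  ∨-assoc : ∀ x y z → (x ∨ y) ∨ z ≈ x ∨ (y ∨ z)
  ∧-comm  : ∀ x y → x ∧ y ≈ y ∧ x
  ∨-comm  : ∀ x y → x ∨ y ≈ y ∨ x
  ∧-absorb : ∀ x y → x ∧ (x ∨ y) ≈ x
  ∨-absorb : ∀ x y → x ∨ (x ∧ y) ≈ x
  ∧-distrib : ∀ x y z → x ∧ (y ∨ z) ≈ (x ∧ y) ∨ (x ∧ z)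
  ∨-distrib : ∀ x y z → x ∨ (y ∧ z) ≈ (x ∨ y) ∧ (x ∨ z)
  ∧-identity : ∀ x → x ∧ 𝟙 ≈ x
  ∨-identity : ∀ x → x ∨ 𝟘 ≈ x
  ~-invol : ∀ x → ~ ~ x ≈ x
  ~-∧     : ∀ x y → ~ (x ∧ y) ≈ ~ x ∨ ~ y
  ~-∨     : ∀ x y → ~ (x ∨ y) ≈ ~ x ∧ ~ y
  ~-𝟘     : ~ 𝟘 ≈ 𝟙
  ~-𝟙     : ~ 𝟙 ≈ 𝟘

-- Objects: finite sets of names, represented (up to
-- the evident equivalence of categories) by n : ℕ standing for Fin n.

Hom : ℕ → ℕ → Set
Hom n m = Fin m → DM n

_≈ₕ_ : ∀ {n m} → Hom n m → Hom n m → Set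
f ≈ₕ g = ∀ x → f x ≈ g x

sub : ∀ {n m} → Hom n m → DM m → DM n
sub f (var x) = f x
sub f 𝟘 = 𝟘
sub f 𝟙 = 𝟙
sub f (x ∧ y) = sub f x ∧ sub f y
sub f (x ∨ y) = sub f x ∨ sub f y
sub f (~ x) = ~ sub f x

idₕ : ∀ {n} → Hom n n
idₕ = var

_∘ₕ_ : ∀ {n m k} → Hom m k → Hom n m → Hom n k
(g ∘ₕ f) x = sub f (g x)

-- Cubical sets: presheaves (of sets) on 𝒞. A functor out of the
-- quotient category is an action on representing terms which respects ≈.

record CSet : Set₁ where
  field
    Ob    : ℕ → Set
    act   : ∀ {n m} → Hom n m → Ob m → Ob n
    act-resp : ∀ {n m} {f g : Hom n m} → f ≈ₕ g → ∀ a → act f a ≡ act g a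
    act-id   : ∀ {n} (a : Ob n) → act idₕ a ≡ a
    act-∘    : ∀ {n m k} (g : Hom m k) (f : Hom n m) (a : Ob k) →
               act (g ∘ₕ f) a ≡ act f (act g a)
open CSet public

Δ : Set → CSet
Δ a = record
  { Ob = λ _ → a ; act = λ _ x → x
  ; act-resp = λ _ _ → _≡_.refl ; act-id = λ _ → _≡_.refl
  ; act-∘ = λ _ _ _ → _≡_.refl }

record _≅_ (A B : CSet) : Set where
  field
    to   : ∀ n → Ob A n → Ob B n
    from : ∀ n → Ob B n → Ob A n
    to-nat   : ∀ {n m} (f : Hom n m) a → to n (act A f a) ≡ act B f (to m a)
    from-nat : ∀ {n m} (f : Hom n m) b → from n (act B f b) ≡ act A f (from m b)
    from-to  : ∀ n a → from n (to n a) ≡ a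
    to-from  : ∀ n b → to n (from n b) ≡ b

-- The exponential A^𝕀 at stage n: natural transformations
-- y(n) × 𝕀 → A, where y(n)(k) = Hom k n and 𝕀(k) = dM(k).
-- Components must respect the setoid equalities on y(n)(k) and dM(k).

record Exp𝕀 (A : CSet) (n : ℕ) : Set where
  field
    fun  : ∀ {k} → Hom k n → DM k → Ob A k
    fun-resp : ∀ {k} {h h' : Hom k n} {t t' : DM k} →
               h ≈ₕ h' → t ≈ t' → fun h t ≡ fun h' t'
    fun-nat  : ∀ {k l} (g : Hom l k) (h : Hom k n) (t : DM k) →
               fun (h ∘ₕ g) (sub g t) ≡ act A g (fun h t)
open Exp𝕀 public

app : ∀ {A n} → Exp𝕀 A n → DM n → Ob A n
app f i = fun f idₕ i

-- Validity of  i : 𝕀, j : 𝕀, f : 𝕀 → A ⊢ f(i) = f(j)  in the topos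
-- (Kripke–Joyal): at every stage n, for every element (i, j, f) of the
-- context 𝕀 × 𝕀 × A^𝕀 at n, the two interpretations agree in A(n).
HoldsConst : CSet → Set
HoldsConst A = ∀ n (i j : DM n) (f : Exp𝕀 A n) → app f i ≡ app f j

module Submission where

-- A cubical set A validates  i j : 𝕀, f : 𝕀 → A ⊢ f(i) = f(j)  exactly when
-- it is discrete: any two parallel cube maps act identically on A.
--
--  * Validity ⇒ discrete.  Two maps h₁ h₂ : k → n are the endpoints of the
--    "segment" t ↦ (t ∧ h₁) ∨ (~t ∧ h₂) : k × 𝕀 → n; restricting x ∈ A(n)
--    along it gives a path in A whose values at 1 and 0 are h₁·x and h₂·x.
--  * Discrete ⇒ A ≅ Δ(A(0)).  The stage 0 is terminal; restricting along a
--    vertex 0 → n and along the unique map n → 0 are mutually inverse.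
--  * A ≅ Δ a ⇒ discrete, since Δ a has the trivial action.
--  * Discrete ⇒ validity.  Every value f(t) of a path is a restriction of
--    its generic point f(var 0) ∈ A(n+1), and restrictions are all equal.

open import Defs
open import Data.Product using (Σ; _,_)
open import Function.Bundles using (_⇔_; mk⇔)
open import Data.Fin using (zero; suc)
open import Data.Nat using (ℕ)
open import Relation.Binary.PropositionalEquality
  using (_≡_; refl; sym; trans; cong; cong₂; module ≡-Reasoning)

≡⇒≈ : ∀ {n} {x y : DM n} → x ≡ y → x ≈ y
≡⇒≈ refl = ≈-refl

sub-resp : ∀ {n m} {h h' : Hom n m} → h ≈ₕ h' → ∀ u → sub h u ≈ sub h' u
sub-resp h≈h' (var x) = h≈h' x
sub-resp h≈h' 𝟘       = ≈-refl
sub-resp h≈h' 𝟙       = ≈-refl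
sub-resp h≈h' (u ∧ v) = ∧-cong (sub-resp h≈h' u) (sub-resp h≈h' v)
sub-resp h≈h' (u ∨ v) = ∨-cong (sub-resp h≈h' u) (sub-resp h≈h' v)
sub-resp h≈h' (~ u)   = ~-cong (sub-resp h≈h' u)

sub-∘ : ∀ {n m k} (g : Hom m k) (f : Hom n m) u → sub (g ∘ₕ f) u ≡ sub f (sub g u)
sub-∘ g f (var x) = refl
sub-∘ g f 𝟘       = refl
sub-∘ g f 𝟙       = refl
sub-∘ g f (u ∧ v) = cong₂ _∧_ (sub-∘ g f u) (sub-∘ g f v)
sub-∘ g f (u ∨ v) = cong₂ _∨_ (sub-∘ g f u) (sub-∘ g f v)
sub-∘ g f (~ u)   = cong ~_ (sub-∘ g f u)

sub-id : ∀ {n} (u : DM n) → sub idₕ u ≡ u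
sub-id (var x) = refl
sub-id 𝟘       = refl
sub-id 𝟙       = refl
sub-id (u ∧ v) = cong₂ _∧_ (sub-id u) (sub-id v)
sub-id (u ∨ v) = cong₂ _∨_ (sub-id u) (sub-id v)
sub-id (~ u)   = cong ~_ (sub-id u)

choose : ∀ {n} → DM n → DM n → DM n → DM n
choose t a b = (t ∧ a) ∨ (~ t ∧ b)

choose-cong : ∀ {n} {t t' a a' b b' : DM n} →
              t ≈ t' → a ≈ a' → b ≈ b' → choose t a b ≈ choose t' a' b'
choose-cong t≈ a≈ b≈ = ∨-cong (∧-cong t≈ a≈) (∧-cong (~-cong t≈) b≈)

𝟙∧ : ∀ {n} (a : DM n) → 𝟙 ∧ a ≈ a
𝟙∧ a = ≈-trans (∧-comm 𝟙 a) (∧-identity a)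

𝟘∨ : ∀ {n} (a : DM n) → 𝟘 ∨ a ≈ a
𝟘∨ a = ≈-trans (∨-comm 𝟘 a) (∨-identity a)

-- 𝟘 is absorbing for ∧:  𝟘 ∧ a ≈ 𝟘 ∧ (𝟘 ∨ a) ≈ 𝟘.
𝟘∧ : ∀ {n} (a : DM n) → 𝟘 ∧ a ≈ 𝟘
𝟘∧ a = ≈-trans (∧-cong ≈-refl (≈-sym (𝟘∨ a))) (∧-absorb 𝟘 a)

choose-𝟙 : ∀ {n} (a b : DM n) → choose 𝟙 a b ≈ a
choose-𝟙 a b =
  ≈-trans (∨-cong (𝟙∧ a) (≈-trans (∧-cong ~-𝟙 ≈-refl) (𝟘∧ b))) (∨-identity a)

choose-𝟘 : ∀ {n} (a b : DM n) → choose 𝟘 a b ≈ b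
choose-𝟘 a b =
  ≈-trans (∨-cong (𝟘∧ a) (≈-trans (∧-cong ~-𝟘 ≈-refl) (𝟙∧ b))) (𝟘∨ b)

Discrete : CSet → Set
Discrete A = ∀ {k n} (h₁ h₂ : Hom k n) (x : Ob A n) → act A h₁ x ≡ act A h₂ x

segment : (A : CSet) {k n : ℕ} → Hom k n → Hom k n → Ob A n → Exp𝕀 A k
segment A {k} {n} h₁ h₂ x = record
  { fun      = λ g t → act A (interpolate g t) x
  ; fun-resp = λ g≈g' t≈t' → act-resp A
      (λ y → choose-cong t≈t' (sub-resp g≈g' (h₁ y)) (sub-resp g≈g' (h₂ y))) x
  ; fun-nat  = λ g h t → trans
      (act-resp A (λ y → choose-cong ≈-refl (≡⇒≈ (sub-∘ h g (h₁ y)))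
                                            (≡⇒≈ (sub-∘ h g (h₂ y)))) x)
      (act-∘ A (interpolate h t) g x)
  }
  where
  interpolate : ∀ {l} → Hom l k → DM l → Hom l n
  interpolate g t y = choose t (sub g (h₁ y)) (sub g (h₂ y))

segment-𝟙 : (A : CSet) {k n : ℕ} (h₁ h₂ : Hom k n) (x : Ob A n) →
            app (segment A h₁ h₂ x) 𝟙 ≡ act A h₁ x
segment-𝟙 A h₁ h₂ x =
  act-resp A (λ y → ≈-trans (choose-𝟙 _ _) (≡⇒≈ (sub-id (h₁ y)))) x

segment-𝟘 : (A : CSet) {k n : ℕ} (h₁ h₂ : Hom k n) (x : Ob A n) →
            app (segment A h₁ h₂ x) 𝟘 ≡ act A h₂ x
segment-𝟘 A h₁ h₂ x =
  act-resp A (λ y → ≈-trans (choose-𝟘 _ _) (≡⇒≈ (sub-id (h₂ y)))) x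

holds⇒discrete : (A : CSet) → HoldsConst A → Discrete A
holds⇒discrete A H {k} h₁ h₂ x = begin
  act A h₁ x                   ≡⟨ sym (segment-𝟙 A h₁ h₂ x) ⟩
  app (segment A h₁ h₂ x) 𝟙    ≡⟨ H k 𝟙 𝟘 (segment A h₁ h₂ x) ⟩
  app (segment A h₁ h₂ x) 𝟘    ≡⟨ segment-𝟘 A h₁ h₂ x ⟩
  act A h₂ x                   ∎
  where open ≡-Reasoning

vertex : ∀ {n} → Hom 0 n
vertex _ = 𝟘

toPoint : ∀ {n} → Hom n 0
toPoint ()

discrete⇒constant : (A : CSet) → Discrete A → A ≅ Δ (Ob A 0)
discrete⇒constant A D = record
  { to       = λ n x → act A vertex x
  ; from     = λ n b → act A toPoint b
  ; to-nat   = λ f a → trans (sym (act-∘ A f vertex a)) (D _ vertex a)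
  ; from-nat = λ f b → trans (D toPoint _ b) (act-∘ A toPoint f b)
  ; from-to  = λ n a → roundTrip vertex toPoint a
  ; to-from  = λ n b → roundTrip toPoint vertex b
  }
  where
  roundTrip : ∀ {k m} (g : Hom m k) (f : Hom k m) (x : Ob A k) →
              act A f (act A g x) ≡ x
  roundTrip g f x =
    trans (sym (act-∘ A g f x)) (trans (D (g ∘ₕ f) idₕ x) (act-id A x))

-- Constant presheaves, and so everything isomorphic to one, are discrete:
-- transported to Δ a, every restriction h·x becomes the identity.
constant⇒discrete : (A : CSet) (a : Set) → A ≅ Δ a → Discrete A
constant⇒discrete A a I {k} {n} h₁ h₂ x = begin
  act A h₁ x                   ≡⟨ sym (from-to k _) ⟩
  from k (to k (act A h₁ x))   ≡⟨ cong (from k) (trans (to-nat h₁ x) (sym (to-nat h₂ x))) ⟩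
  from k (to k (act A h₂ x))   ≡⟨ from-to k _ ⟩
  act A h₂ x                   ∎
  where
  open _≅_ I
  open ≡-Reasoning

-- The generic point of a path f ∈ (𝕀 → A)(n): f evaluated at the fresh
-- variable of the (n+1)-cube.  Substituting t for that variable recovers f(t).
weaken : ∀ {n} → Hom (ℕ.suc n) n
weaken x = var (suc x)

instantiate : ∀ {n} → DM n → Hom n (ℕ.suc n)
instantiate t zero    = t
instantiate t (suc x) = var x

genericPoint : ∀ {A n} → Exp𝕀 A n → Ob A (ℕ.suc n)
genericPoint f = fun f weaken (var zero)

app-generic : (A : CSet) {n : ℕ} (f : Exp𝕀 A n) (t : DM n) →
              app f t ≡ act A (instantiate t) (genericPoint f)
app-generic A f t = fun-nat f (instantiate t) weaken (var zero)

discrete⇒holds : (A : CSet) → Discrete A → HoldsConst A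
discrete⇒holds A D n i j f = begin
  app f i                                   ≡⟨ app-generic A f i ⟩
  act A (instantiate i) (genericPoint f)    ≡⟨ D (instantiate i) (instantiate j) _ ⟩
  act A (instantiate j) (genericPoint f)    ≡⟨ sym (app-generic A f j) ⟩
  app f j                                   ∎
  where open ≡-Reasoning

mainTheorem6 : (A : CSet) → HoldsConst A ⇔ Σ Set (λ a → A ≅ Δ a)
mainTheorem6 A = mk⇔
  (λ H → Ob A 0 , discrete⇒constant A (holds⇒discrete A H))
  (λ { (a , I) → discrete⇒holds A (constant⇒discrete A a I) })
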